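{- For every finite simple graph $G$, $\Gamma_{odd}(G)\leq IR_{odd}(G)$ and $ir_{odd}(G)\leq\gamma_{odd}(G)$.
   Context: For $S\subseteq V$, $\langle S\rangle$ is the induced subgraph; maximal/minimal are with respect to inclusion. $S$ is odd-cycle dominating if for every $v\in V\setminus S$ there is $u\in S$ such that $u$ and $v$ lie on a common odd cycle of $\langle S\cup\{v\}\rangle$; $\Gamma_{odd}(G)$ is the maximum and $\gamma_{odd}(G)$ the minimum size of a minimal odd-cycle dominating set. For $T\subseteq V$ and $x\in V$, say $T$ dominates $x$ if $x\in T$, or $x\notin T$ and there is $w\in T$ such that $x,w$ lie on a common odd cycle of $\langle T\cup\{x\}\rangle$. $S$ is odd-cycle irredundant if for every $v\in S$ there exists $u\in (V\setminus S)\cup\{v\}$ such that $S$ dominates $u$ but $S\setminus\{v\}$ does not dominate $u$. $IR_{odd}(G)$ is the maximum size of an odd-cycle irredundant set and $ir_{odd}(G)$ the minimum size of a maximal one. -}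

module Defs where

open import Data.Bool using (Bool; true; false)
open import Data.Nat using (ℕ; zero; suc; _*_; _≤_)
open import Data.Fin using (Fin)
open import Data.Fin.Subset using (Subset; _∈_; _∉_; _∪_; ⁅_⁆; _-_; _⊂_; ∣_∣)
open import Data.List using (List; []; _∷_; _++_; length)
open import Data.List.Relation.Unary.All using (All)
open import Data.List.Relation.Unary.Unique.Propositional using (Unique)
import Data.List.Membership.Propositional as LM
open import Data.Product using (Σ; ∃; _×_; _,_)
open import Data.Sum using (_⊎_)
open import Data.Unit using (⊤)
open import Data.Empty using (⊥)
open import Relation.Nullary using (¬_)
open import Relation.Binary.PropositionalEquality using (_≡_)

record Graph (n : ℕ) : Set where
  field
    edge  : Fin n → Fin n → Bool
    sym   : ∀ u v → edge u v ≡ edge v u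
    irrefl : ∀ v → edge v v ≡ false

module _ {n : ℕ} (G : Graph n) where
  open Graph G

  Adj : Fin n → Fin n → Set
  Adj u v = edge u v ≡ true

  Chain : List (Fin n) → Set
  Chain []            = ⊤
  Chain (x ∷ [])      = ⊤
  Chain (x ∷ y ∷ r)   = Adj x y × Chain (y ∷ r)

  Closed : List (Fin n) → Set
  Closed []      = ⊥
  Closed (x ∷ r) = Chain ((x ∷ r) ++ (x ∷ []))

  record OddCycleIn (T : Subset n) : Set where
    field
      verts   : List (Fin n)
      half    : ℕ
      oddLen  : length verts ≡ suc (2 * half)
      long    : 3 ≤ length verts
      distinct : Unique verts
      closed  : Closed verts
      inT     : All (_∈ T) verts

  CommonOddCycle : Subset n → Fin n → Fin n → Set
  CommonOddCycle T x w =
    Σ (OddCycleIn T) λ C → (x LM.∈ OddCycleIn.verts C) × (w LM.∈ OddCycleIn.verts C)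

  OddCycleDominating : Subset n → Set
  OddCycleDominating S =
    ∀ v → v ∉ S → Σ (Fin n) λ u → u ∈ S × CommonOddCycle (S ∪ ⁅ v ⁆) u v

  MinimalOCD : Subset n → Set
  MinimalOCD S = OddCycleDominating S × (∀ S′ → S′ ⊂ S → ¬ OddCycleDominating S′)

  Dominates : Subset n → Fin n → Set
  Dominates T x =
    x ∈ T ⊎ (x ∉ T × Σ (Fin n) λ w → w ∈ T × CommonOddCycle (T ∪ ⁅ x ⁆) x w)

  Irredundant : Subset n → Set
  Irredundant S =
    ∀ v → v ∈ S → Σ (Fin n) λ u → (u ∉ S ⊎ u ≡ v) × Dominates S u × ¬ Dominates (S - v) u

  MaximalIrredundant : Subset n → Set
  MaximalIrredundant S = Irredundant S × (∀ S′ → S ⊂ S′ → ¬ Irredundant S′)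

IsMaxSize : {n : ℕ} → (Subset n → Set) → ℕ → Set
IsMaxSize P k = (Σ _ λ S → P S × ∣ S ∣ ≡ k) × (∀ S → P S → ∣ S ∣ ≤ k)

IsMinSize : {n : ℕ} → (Subset n → Set) → ℕ → Set
IsMinSize P k = (Σ _ λ S → P S × ∣ S ∣ ≡ k) × (∀ S → P S → k ≤ ∣ S ∣)

Γodd : {n : ℕ} → Graph n → ℕ → Set
Γodd G = IsMaxSize (MinimalOCD G)

γodd : {n : ℕ} → Graph n → ℕ → Set
γodd G = IsMinSize (MinimalOCD G)

IRodd : {n : ℕ} → Graph n → ℕ → Set
IRodd G = IsMaxSize (Irredundant G)

irodd : {n : ℕ} → Graph n → ℕ → Set
irodd G = IsMinSize (MaximalIrredundant G)

-- A minimal odd-cycle dominating set S is irredundant: for v ∈ S the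
-- proper subset S - v is not dominating, so some vertex u is dominated by
-- S but not by S - v, and u is then a private vertex of v.  It is even
-- maximal irredundant: every vertex is dominated by S, hence by S′ - v
-- for any proper superset S′ and v ∈ S′ - S, so v has no private vertex
-- in S′.  Thus the largest minimal dominating set is irredundant and the
-- smallest one is maximal irredundant.  Choosing the private vertices is
-- classical, but the reasoning takes place over the finite vertex set and
-- the conclusions are decidable inequalities, so double negation suffices.
module Submission where

open import Defs
open import Data.Nat using (ℕ; _≤_)
open import Data.Nat.Properties using (_≤?_)
open import Data.Product using (_×_; _,_; Σ; ∃)
open import Data.Sum using (_⊎_; inj₁; inj₂)
open import Data.Fin using (Fin; zero; suc)
open import Data.Fin.Properties using (_≟_)
open import Data.Fin.Subset using (Subset; _∉_; _∪_; ⁅_⁆; _-_; _⊂_; _⊆_)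
open import Data.Fin.Subset.Properties
  using (_∈?_; x∈p∪q⁻; x∈p∪q⁺; x∈p∧x≢y⇒x∈p-y; x∈p⇒p-x⊂p)
open import Data.List.Relation.Unary.All as All using ()
open import Relation.Nullary using (¬_; yes; no)
open import Relation.Nullary.Negation using (contradiction; ¬¬-map; ¬∃⟶∀¬)
open import Relation.Nullary.Decidable using (decidable-stable)
open import Relation.Binary.PropositionalEquality using (_≡_; refl)

¬¬-pull-Fin : ∀ {n} {P : Fin n → Set} → (∀ i → ¬ ¬ P i) → ¬ ¬ (∀ i → P i)
¬¬-pull-Fin {ℕ.zero}      ¬¬P ¬∀P = ¬∀P (λ ())
¬¬-pull-Fin {ℕ.suc n} {P} ¬¬P ¬∀P =
  ¬¬P zero λ P₀ → ¬¬-pull-Fin {P = λ i → P (suc i)} (λ i → ¬¬P (suc i))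
    λ P₊ → ¬∀P λ { zero → P₀ ; (suc i) → P₊ i }

¬¬-pull-→ : {A B : Set} → (A → ¬ ¬ B) → ¬ ¬ (A → B)
¬¬-pull-→ f ¬[A→B] = ¬[A→B] λ a → contradiction (λ b → ¬[A→B] λ _ → b) (f a)

¬∀⇒¬¬∃¬-Fin : ∀ {n} {P : Fin n → Set} → ¬ (∀ i → P i) → ¬ ¬ ∃ λ i → ¬ P i
¬∀⇒¬¬∃¬-Fin ¬∀P ¬∃¬P = ¬¬-pull-Fin (¬∃⟶∀¬ ¬∃¬P) ¬∀P

∪-monoˡ-⊆ : ∀ {n} {p q : Subset n} (r : Subset n) → p ⊆ q → p ∪ r ⊆ q ∪ r
∪-monoˡ-⊆ {p = p} r p⊆q x∈p∪r with x∈p∪q⁻ p r x∈p∪r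
... | inj₁ x∈p = x∈p∪q⁺ (inj₁ (p⊆q x∈p))
... | inj₂ x∈r = x∈p∪q⁺ (inj₂ x∈r)

module _ {n : ℕ} (G : Graph n) where

  DominatesAll : Subset n → Set
  DominatesAll S = ∀ x → Dominates G S x

  commonOddCycle-sym : ∀ {T x w} → CommonOddCycle G T x w → CommonOddCycle G T w x
  commonOddCycle-sym (C , x∈C , w∈C) = C , w∈C , x∈C

  oddCycleIn-mono : ∀ {T T′} → T ⊆ T′ → OddCycleIn G T → OddCycleIn G T′
  oddCycleIn-mono T⊆T′ C = record
    { verts = verts ; half = half ; oddLen = oddLen ; long = long
    ; distinct = distinct ; closed = closed ; inT = All.map T⊆T′ inT }
    where open OddCycleIn C

  commonOddCycle-mono : ∀ {T T′ x w} → T ⊆ T′ →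
                        CommonOddCycle G T x w → CommonOddCycle G T′ x w
  commonOddCycle-mono T⊆T′ (C , x∈C , w∈C) = oddCycleIn-mono T⊆T′ C , x∈C , w∈C

  dominates-mono : ∀ {T T′} x → T ⊆ T′ → Dominates G T x → Dominates G T′ x
  dominates-mono {T′ = T′} x T⊆T′ dom with x ∈? T′
  ... | yes x∈T′ = inj₁ x∈T′
  ... | no  x∉T′ with dom
  ...   | inj₁ x∈T                  = contradiction (T⊆T′ x∈T) x∉T′
  ...   | inj₂ (_ , w , w∈T , cyc) =
          inj₂ (x∉T′ , w , T⊆T′ w∈T , commonOddCycle-mono (∪-monoˡ-⊆ ⁅ x ⁆ T⊆T′) cyc)

  ocd⇒dominatesAll : ∀ {S} → OddCycleDominating G S → DominatesAll S
  ocd⇒dominatesAll {S} ocd x with x ∈? S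
  ... | yes x∈S = inj₁ x∈S
  ... | no  x∉S with ocd x x∉S
  ...   | w , w∈S , cyc = inj₂ (x∉S , w , w∈S , commonOddCycle-sym cyc)

  dominatesAll⇒ocd : ∀ {S} → DominatesAll S → OddCycleDominating G S
  dominatesAll⇒ocd domAll x x∉S with domAll x
  ... | inj₁ x∈S                  = contradiction x∈S x∉S
  ... | inj₂ (_ , w , w∈S , cyc) = w , w∈S , commonOddCycle-sym cyc

  undominated⇒private : ∀ {S v x} → ¬ Dominates G (S - v) x → x ∉ S ⊎ x ≡ v
  undominated⇒private {v = v} {x} ¬dom with x ≟ v
  ... | yes x≡v = inj₂ x≡v
  ... | no  x≢v = inj₁ λ x∈S → ¬dom (inj₁ (x∈p∧x≢y⇒x∈p-y x∈S x≢v))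

  minimalOCD⇒¬¬irredundant : ∀ {S} → MinimalOCD G S → ¬ ¬ Irredundant G S
  minimalOCD⇒¬¬irredundant {S} (ocd , minimal) =
    ¬¬-pull-Fin λ v → ¬¬-pull-→ λ v∈S → ¬¬-map (privateVertex v)
      (¬∀⇒¬¬∃¬-Fin λ domAll → minimal (S - v) (x∈p⇒p-x⊂p v∈S) (dominatesAll⇒ocd domAll))
    where
    privateVertex : ∀ v → ∃ (λ u → ¬ Dominates G (S - v) u) →
                    Σ (Fin n) λ u → (u ∉ S ⊎ u ≡ v) × Dominates G S u × ¬ Dominates G (S - v) u
    privateVertex v (u , ¬dom) = u , undominated⇒private ¬dom , ocd⇒dominatesAll ocd u , ¬dom

  dominatesAll-⊂⇒¬irredundant : ∀ {S S′} → DominatesAll S → S ⊂ S′ → ¬ Irredundant G S′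
  dominatesAll-⊂⇒¬irredundant {S} {S′} domAll (S⊆S′ , v , v∈S′ , v∉S) irr
    with irr v v∈S′
  ... | u , _ , _ , ¬dom = ¬dom (dominates-mono u S⊆S′-v (domAll u))
    where
    S⊆S′-v : S ⊆ S′ - v
    S⊆S′-v x∈S = x∈p∧x≢y⇒x∈p-y (S⊆S′ x∈S) λ { refl → v∉S x∈S }

  minimalOCD⇒¬¬maximalIrredundant : ∀ {S} → MinimalOCD G S → ¬ ¬ MaximalIrredundant G S
  minimalOCD⇒¬¬maximalIrredundant min@(ocd , _) = ¬¬-map
    (λ irr → irr , λ _ S⊂S′ → dominatesAll-⊂⇒¬irredundant (ocd⇒dominatesAll ocd) S⊂S′)
    (minimalOCD⇒¬¬irredundant min)

mainTheorem19 : {n : ℕ} (G : Graph n) →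
    (∀ a b → Γodd G a → IRodd G b → a ≤ b) ×
    (∀ c d → irodd G c → γodd G d → c ≤ d)
mainTheorem19 G = Γodd≤IRodd , irodd≤γodd
  where
  Γodd≤IRodd : ∀ a b → Γodd G a → IRodd G b → a ≤ b
  Γodd≤IRodd a b ((S , min , refl) , _) (_ , largest) =
    decidable-stable (a ≤? b) (¬¬-map (largest S) (minimalOCD⇒¬¬irredundant G min))

  irodd≤γodd : ∀ c d → irodd G c → γodd G d → c ≤ d
  irodd≤γodd c d (_ , smallest) ((S , min , refl) , _) =
    decidable-stable (c ≤? d) (¬¬-map (smallest S) (minimalOCD⇒¬¬maximalIrredundant G min))
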